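{- Let $q$ be a complex number (nonzero) and let $n\ge 0$ be an integer. Define the (finite) sums $$S_1(n)=\sum_{k\in\mathbb Z} q^{3k^2-k-3kn}\begin{bmatrix}n\\ 3k-n\end{bmatrix}_q,\qquad S_2(n)=q^{ -n}\sum_{k\in\mathbb Z} q^{3k^2+k-3kn}\begin{bmatrix}n\\ 3k+1-n\end{bmatrix}_q,$$ $$S_3(n)=\sum_{k\in\mathbb Z} q^{3k^2-k-3kn}\begin{bmatrix}n\\ 3k-1-n\end{bmatrix}_q.$$ Then (i) $S_2(n)=S_3(n)$, and (ii) $S_1(n)-S_3(n)=(-1)^n q^{ -\binom{n+1}{2}}$.
   Context: For a non-negative integer $k$, $(q;q)_k=\prod_{j=1}^{k}(1-q^j)$, with the convention $1/(q;q)_k=0$ for $k<0$. The $q$-binomial coefficient is $\begin{bmatrix}n\\ j\end{bmatrix}_q=\frac{(q;q)_n}{(q;q)_j(q;q)_{n-j}}$, which equals $0$ when $j<0$ or $j>n$; hence each of the sums has only finitely many nonzero terms. -}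

module Defs where

open import Level using (Level)
open import Algebra.Bundles using (CommutativeRing)
open import Data.Nat using (ℕ; zero; suc) renaming (_+_ to _+ℕ_; _*_ to _*ℕ_)
open import Data.Integer using (ℤ; +_; -[1+_]) renaming (_+_ to _+ℤ_; _-_ to _-ℤ_; _*_ to _*ℤ_; -_ to -ℤ_)
open import Data.Nat.Combinatorics using (_C_)

-- Everything is parametrised by a commutative ring R, an element q of R
-- and a chosen inverse qinv of q (the hypothesis q * qinv ≈ 1 is in the statement).
module QDefs {c ℓ : Level} (R : CommutativeRing c ℓ) (q qinv : CommutativeRing.Carrier R) where
  open CommutativeRing R

  _^ᴺ_ : Carrier → ℕ → Carrier
  x ^ᴺ zero = 1#
  x ^ᴺ suc n = x * (x ^ᴺ n)

  qpow : ℤ → Carrier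
  qpow (+ n) = q ^ᴺ n
  qpow -[1+ n ] = qinv ^ᴺ suc n

  -- Gaussian (q-)binomial coefficient [n choose j]_q, as the polynomial in q
  -- given by the q-Pascal rule [n+1, j+1] = [n, j] + q^(j+1) [n, j+1];
  -- it is 0 for j > n.
  qbin : ℕ → ℕ → Carrier
  qbin _ zero = 1#
  qbin zero (suc j) = 0#
  qbin (suc n) (suc j) = qbin n j + (q ^ᴺ suc j) * qbin n (suc j)

  qbinℤ : ℕ → ℤ → Carrier
  qbinℤ n (+ j) = qbin n j
  qbinℤ n -[1+ _ ] = 0#

  sumℕ : ℕ → (ℕ → Carrier) → Carrier
  sumℕ zero f = 0#
  sumℕ (suc m) f = f m + sumℕ m f

  -- Σ_{k = -N}^{N} f k
  sumℤ : ℕ → (ℤ → Carrier) → Carrier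
  sumℤ N f = sumℕ (suc (2 *ℕ N)) (λ i → f (+ i -ℤ + N))

  -- all nonzero terms of S1, S2, S3 have 0 ≤ k ≤ n, so the sum over
  -- -(n+1) ≤ k ≤ n+1 is the full sum over k ∈ ℤ.
  S₁ : ℕ → Carrier
  S₁ n = sumℤ (suc n) (λ k →
           qpow (+ 3 *ℤ k *ℤ k -ℤ k -ℤ + 3 *ℤ k *ℤ + n) * qbinℤ n (+ 3 *ℤ k -ℤ + n))

  S₂ : ℕ → Carrier
  S₂ n = qpow (-ℤ (+ n)) * sumℤ (suc n) (λ k →
           qpow (+ 3 *ℤ k *ℤ k +ℤ k -ℤ + 3 *ℤ k *ℤ + n) * qbinℤ n (+ 3 *ℤ k +ℤ + 1 -ℤ + n))

  S₃ : ℕ → Carrier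
  S₃ n = sumℤ (suc n) (λ k →
           qpow (+ 3 *ℤ k *ℤ k -ℤ k -ℤ + 3 *ℤ k *ℤ + n) * qbinℤ n (+ 3 *ℤ k -ℤ + 1 -ℤ + n))

  RHS : ℕ → Carrier
  RHS n = ((- 1#) ^ᴺ n) * qpow (-ℤ (+ (suc n C 2)))

{-# OPTIONS --safe #-}
module Submission where

open import Defs
open import Level using (Level)
open import Algebra.Bundles using (CommutativeRing)
open import Data.Nat using (ℕ; zero; suc; _<_; _≤_; s≤s; z≤n; _∸_) renaming (_+_ to _+ℕ_)
import Data.Nat.Properties as ℕ
open import Data.Nat.Combinatorics using (_C_; nC1≡n; nCk+nC[k+1]≡[n+1]C[k+1])
open import Data.Integer using (ℤ; +_; -[1+_]; _⊖_) renaming (_+_ to _+ℤ_; _-_ to _-ℤ_; _*_ to _*ℤ_; -_ to -ℤ_)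
import Data.Integer.Properties as ℤ
open import Data.Integer.Tactic.RingSolver using (solve-∀)
open import Data.Product using (_×_; _,_)
open import Data.Sum using (inj₁; inj₂)
open import Data.Maybe using (nothing)
open import Relation.Binary.PropositionalEquality using (_≡_; cong; cong₂) renaming (refl to ≡-refl; sym to ≡-sym; trans to ≡-trans)
open import Tactic.RingSolver.Core.AlmostCommutativeRing using (fromCommutativeRing)

-- Every summand vanishes outside 0 ≤ k ≤ n, so all sums may be taken over that range.
-- (i) By the symmetry [n, j] = [n, n − j], the reflection k ↦ n − k carries the k-th term of
-- q^(−n) S₂(n) to the (n − k)-th term of S₃(n).
-- (ii) Expand the k-th term of S₁(n+1) by [n+1, j] = [n, j−1] + q^j [n, j] and that of S₃(n+1) by
-- [n+1, j] = q^(n+1−j) [n, j−1] + [n, j]. A common term cancels and the difference is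
-- q^(−n−1) (t₃(n, k) − t₁(n, k−1)), where tᵢ(n, k) is the k-th term of Sᵢ(n). Summing over k gives
-- S₁(n+1) − S₃(n+1) = −q^(−n−1) (S₁(n) − S₃(n)), and induction from S₁(0) − S₃(0) = 1 gives (ii).

[+m]-[+n]≡+[m∸n] : ∀ {m n} → n ≤ m → + m -ℤ + n ≡ + (m ∸ n)
[+m]-[+n]≡+[m∸n] {m} {n} n≤m = ≡-trans (ℤ.[+m]-[+n]≡m⊖n m n) (ℤ.⊖-≥ n≤m)

[+m+n]-[+n]≡+m : ∀ m n → + (m +ℕ n) -ℤ + n ≡ + m
[+m+n]-[+n]≡+m m n = ≡-trans ([+m]-[+n]≡+[m∸n] (ℕ.m≤n+m n m)) (cong +_ (ℕ.m+n∸n≡m m n))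

[+m]-[+n]≡-[1+n∸1+m] : ∀ {m n} → m < n → + m -ℤ + n ≡ -[1+ (n ∸ suc m) ]
[+m]-[+n]≡-[1+n∸1+m] {m} {suc n} (s≤s m≤n) = ≡-trans (ℤ.[+m]-[+n]≡m⊖n m (suc n))
  (≡-trans (ℤ.⊖-< (s≤s m≤n)) (cong (λ k → -ℤ (+ k)) (ℕ.+-∸-assoc 1 m≤n)))

module _ {c ℓ : Level} (R : CommutativeRing c ℓ) (q qinv : CommutativeRing.Carrier R) where
  open CommutativeRing R
  open QDefs R q qinv
  open import Relation.Binary.Reasoning.Setoid setoid
  open import Algebra.Properties.CommutativeSemigroup +-commutativeSemigroup using (x∙yz≈y∙xz)
  open import Algebra.Properties.CommutativeSemigroup *-commutativeSemigroup
    using (interchange) renaming (x∙yz≈y∙xz to x*[y*z]≈y*[x*z])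
  open import Algebra.Properties.AbelianGroup +-abelianGroup using (ε⁻¹≈ε; ⁻¹-∙-comm; ⁻¹-anti-homo‿-)
  open import Algebra.Properties.Ring ring using (-‿distribˡ-*; -1*x≈-x; x[y-z]≈xy-xz)
  open import Tactic.RingSolver.NonReflective (fromCommutativeRing R (λ _ → nothing)) using (solve; _⊜_; _⊕_; _⊗_; ⊝_)

  ≡⇒≈ : ∀ {x y} → x ≡ y → x ≈ y
  ≡⇒≈ ≡-refl = refl

  [x+y]-[x+z]≈y-z : ∀ x y z → (x + y) - (x + z) ≈ y - z
  [x+y]-[x+z]≈y-z x y z = begin
      (x + y) + - (x + z)    ≈⟨ +-cong refl (⁻¹-∙-comm x z) ⟨
      (x + y) + (- x + - z)  ≈⟨ solve 3 (λ x y z → ((x ⊕ y) ⊕ (⊝ x ⊕ ⊝ z)) ⊜ ((x ⊕ ⊝ x) ⊕ (y ⊕ ⊝ z))) refl x y z ⟩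
      (x + - x) + (y + - z)  ≈⟨ +-cong (-‿inverseʳ x) refl ⟩
      0# + (y - z)           ≈⟨ +-identityˡ _ ⟩
      y - z                  ∎

  ^ᴺ-homo-* : ∀ x m n → x ^ᴺ (m +ℕ n) ≈ x ^ᴺ m * x ^ᴺ n
  ^ᴺ-homo-* x zero n = sym (*-identityˡ _)
  ^ᴺ-homo-* x (suc m) n = trans (*-cong refl (^ᴺ-homo-* x m n)) (sym (*-assoc _ _ _))

  sumℕ-cong : ∀ m {f g : ℕ → Carrier} → (∀ i → i < m → f i ≈ g i) → sumℕ m f ≈ sumℕ m g
  sumℕ-cong zero f≈g = refl
  sumℕ-cong (suc m) f≈g = +-cong (f≈g m ℕ.≤-refl) (sumℕ-cong m (λ i i<m → f≈g i (ℕ.m<n⇒m<1+n i<m)))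

  sumℕ-zero : ∀ m (f : ℕ → Carrier) → (∀ i → i < m → f i ≈ 0#) → sumℕ m f ≈ 0#
  sumℕ-zero m f f≈0 = trans (sumℕ-cong m f≈0) (sumℕ-const0 m)
    where
      sumℕ-const0 : ∀ m → sumℕ m (λ _ → 0#) ≈ 0#
      sumℕ-const0 zero = refl
      sumℕ-const0 (suc m) = trans (+-identityˡ _) (sumℕ-const0 m)

  sumℕ-*ˡ : ∀ m x (f : ℕ → Carrier) → sumℕ m (λ i → x * f i) ≈ x * sumℕ m f
  sumℕ-*ˡ zero x f = sym (zeroʳ x)
  sumℕ-*ˡ (suc m) x f = trans (+-cong refl (sumℕ-*ˡ m x f)) (sym (distribˡ _ _ _))

  sumℕ-minus : ∀ m (f g : ℕ → Carrier) → sumℕ m (λ i → f i - g i) ≈ sumℕ m f - sumℕ m g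
  sumℕ-minus zero f g = sym (-‿inverseʳ 0#)
  sumℕ-minus (suc m) f g = trans (+-cong refl (sumℕ-minus m f g))
    (solve 4 (λ a b x y → ((a ⊕ ⊝ b) ⊕ (x ⊕ ⊝ y)) ⊜ ((a ⊕ x) ⊕ ⊝ (b ⊕ y))) refl (f m) (g m) (sumℕ m f) (sumℕ m g))

  sumℕ-split : ∀ a b (f : ℕ → Carrier) → sumℕ (b +ℕ a) f ≈ sumℕ b (λ i → f (i +ℕ a)) + sumℕ a f
  sumℕ-split a zero f = sym (+-identityˡ _)
  sumℕ-split a (suc b) f = trans (+-cong refl (sumℕ-split a b f)) (sym (+-assoc _ _ _))

  sumℕ-suc-head : ∀ m (f : ℕ → Carrier) → sumℕ (suc m) f ≈ f 0 + sumℕ m (λ i → f (suc i))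
  sumℕ-suc-head zero f = refl
  sumℕ-suc-head (suc m) f = trans (+-cong refl (sumℕ-suc-head m f)) (x∙yz≈y∙xz _ _ _)

  sumℕ-reverse : ∀ m (f : ℕ → Carrier) → sumℕ m f ≈ sumℕ m (λ i → f (m ∸ suc i))
  sumℕ-reverse zero f = refl
  sumℕ-reverse (suc m) f = trans (+-cong refl (sumℕ-reverse m f)) (sym (sumℕ-suc-head m (λ i → f (m ∸ i))))

  VanishesOutside : ℕ → (ℤ → Carrier) → Set ℓ
  VanishesOutside n f = (∀ m → f -[1+ m ] ≈ 0#) × (∀ t → f (+ suc (n +ℕ t)) ≈ 0#)

  sumℕ-window : ∀ a b n {N} (f : ℤ → Carrier) → N ≡ b +ℕ (suc n +ℕ a) → VanishesOutside n f →
                sumℕ N (λ i → f (+ i -ℤ + a)) ≈ sumℕ (suc n) (λ i → f (+ i))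
  sumℕ-window a b n f ≡-refl (below , above) = begin
      sumℕ (b +ℕ (suc n +ℕ a)) g
        ≈⟨ sumℕ-split (suc n +ℕ a) b g ⟩
      sumℕ b (λ i → g (i +ℕ (suc n +ℕ a))) + sumℕ (suc n +ℕ a) g
        ≈⟨ +-cong (sumℕ-zero b _ top) (sumℕ-split a (suc n) g) ⟩
      0# + (sumℕ (suc n) (λ i → g (i +ℕ a)) + sumℕ a g)
        ≈⟨ +-cong refl (+-cong (sumℕ-cong (suc n) middle) (sumℕ-zero a g bottom)) ⟩
      0# + (sumℕ (suc n) (λ i → f (+ i)) + 0#)
        ≈⟨ trans (+-identityˡ _) (+-identityʳ _) ⟩
      sumℕ (suc n) (λ i → f (+ i)) ∎
    where
      g : ℕ → Carrier
      g i = f (+ i -ℤ + a)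
      top : ∀ i → i < b → g (i +ℕ (suc n +ℕ a)) ≈ 0#
      top i _ = trans (≡⇒≈ (cong f (≡-trans (cong (λ m → + m -ℤ + a) i+[1+n+a]≡1+n+i+a)
                                            ([+m+n]-[+n]≡+m (suc (n +ℕ i)) a))))
                      (above i)
        where
          i+[1+n+a]≡1+n+i+a : i +ℕ (suc n +ℕ a) ≡ suc (n +ℕ i) +ℕ a
          i+[1+n+a]≡1+n+i+a = ≡-trans (≡-sym (ℕ.+-assoc i (suc n) a)) (cong (_+ℕ a) (ℕ.+-comm i (suc n)))
      middle : ∀ i → i < suc n → g (i +ℕ a) ≈ f (+ i)
      middle i _ = ≡⇒≈ (cong f ([+m+n]-[+n]≡+m i a))
      bottom : ∀ i → i < a → g i ≈ 0#
      bottom i i<a = trans (≡⇒≈ (cong f ([+m]-[+n]≡-[1+n∸1+m] i<a))) (below (a ∸ suc i))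

  sumℕ-support-suc : ∀ n (f : ℤ → Carrier) → VanishesOutside n f →
                     sumℕ (suc (suc n)) (λ i → f (+ i)) ≈ sumℕ (suc n) (λ i → f (+ i))
  sumℕ-support-suc n f (_ , above) =
    trans (+-cong (trans (≡⇒≈ (cong (λ t → f (+ suc t)) (≡-sym (ℕ.+-identityʳ n)))) (above 0)) refl) (+-identityˡ _)

  sumℤ-support : ∀ n (f : ℤ → Carrier) → VanishesOutside n f → sumℤ (suc n) f ≈ sumℕ (suc n) (λ i → f (+ i))
  sumℤ-support n f = sumℕ-window (suc n) 1 n f (cong (λ m → suc (suc n +ℕ m)) (ℕ.+-identityʳ (suc n)))

  qbin-above : ∀ {n j} → n < j → qbin n j ≈ 0#
  qbin-above {zero} {suc j} _ = refl
  qbin-above {suc n} {suc j} (s≤s n<j) =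
    trans (+-cong (qbin-above n<j) (*-cong refl (qbin-above (ℕ.m<n⇒m<1+n n<j))))
          (trans (+-identityˡ _) (zeroʳ _))

  *-qbin-above : ∀ x {n j} → n < j → x * qbin n j ≈ 0#
  *-qbin-above x n<j = trans (*-cong refl (qbin-above n<j)) (zeroʳ x)

  qbin-diag : ∀ n → qbin n n ≈ 1#
  qbin-diag zero = refl
  qbin-diag (suc n) = trans (+-cong (qbin-diag n) (*-qbin-above _ (ℕ.n<1+n n))) (+-identityʳ 1#)

  *-qbin-cong : ∀ {x y} n j → (j ≤ n → x ≈ y) → x * qbin n j ≈ y * qbin n j
  *-qbin-cong n j x≈y with ℕ.≤-<-connex j n
  ... | inj₁ j≤n = *-cong (x≈y j≤n) refl
  ... | inj₂ n<j = trans (*-qbin-above _ n<j) (sym (*-qbin-above _ n<j))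

  -- For j > n the exponent n ∸ j is truncated, harmlessly: then qbin n j ≈ 0#.
  qbin-pascalʳ : ∀ n j → qbin (suc n) (suc j) ≈ q ^ᴺ (n ∸ j) * qbin n j + qbin n (suc j)
  qbin-pascalʳ zero zero = +-cong (sym (*-identityˡ 1#)) (zeroʳ _)
  qbin-pascalʳ zero (suc j) = trans (+-cong refl (zeroʳ _)) (trans (+-comm _ _) (+-cong (sym (zeroʳ _)) refl))
  qbin-pascalʳ (suc n) zero = begin
      1# + q ^ᴺ 1 * qbin (suc n) 1
        ≈⟨ +-cong refl (*-cong (*-identityʳ q) (qbin-pascalʳ n 0)) ⟩
      1# + q * (q ^ᴺ n * 1# + qbin n 1)
        ≈⟨ +-cong refl (*-cong refl (+-cong (*-identityʳ _) refl)) ⟩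
      1# + q * (q ^ᴺ n + qbin n 1)
        ≈⟨ solve 4 (λ o x y z → (o ⊕ x ⊗ (y ⊕ z)) ⊜ (x ⊗ y ⊕ (o ⊕ x ⊗ z))) refl 1# q (q ^ᴺ n) (qbin n 1) ⟩
      q ^ᴺ suc n + (1# + q * qbin n 1)
        ≈⟨ +-cong (sym (*-identityʳ _)) (+-cong refl (*-cong (sym (*-identityʳ q)) refl)) ⟩
      q ^ᴺ suc n * 1# + (1# + q ^ᴺ 1 * qbin n 1) ∎
  qbin-pascalʳ (suc n) (suc j) = begin
      qbin (suc n) (suc j) + Q₂ * qbin (suc n) (suc (suc j))
        ≈⟨ +-cong (qbin-pascalʳ n j) (*-cong refl (qbin-pascalʳ n (suc j))) ⟩
      (A * a + b) + Q₂ * (D * b + d)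
        ≈⟨ solve 6 (λ A a b Q₂ D d → ((A ⊗ a ⊕ b) ⊕ Q₂ ⊗ (D ⊗ b ⊕ d)) ⊜ (A ⊗ a ⊕ b ⊕ (Q₂ ⊗ D) ⊗ b ⊕ Q₂ ⊗ d))
                   refl A a b Q₂ D d ⟩
      A * a + b + (Q₂ * D) * b + Q₂ * d
        ≈⟨ +-cong (+-cong refl (*-qbin-cong n (suc j) exponents)) refl ⟩
      A * a + b + (A * Q₁) * b + Q₂ * d
        ≈⟨ solve 6 (λ A a b Q₂ d Q₁ → (A ⊗ a ⊕ b ⊕ (A ⊗ Q₁) ⊗ b ⊕ Q₂ ⊗ d) ⊜ (A ⊗ (a ⊕ Q₁ ⊗ b) ⊕ (b ⊕ Q₂ ⊗ d)))
                   refl A a b Q₂ d Q₁ ⟩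
      A * (a + Q₁ * b) + (b + Q₂ * d) ∎
    where
      A = q ^ᴺ (n ∸ j)
      D = q ^ᴺ (n ∸ suc j)
      Q₁ = q ^ᴺ suc j
      Q₂ = q ^ᴺ suc (suc j)
      a = qbin n j
      b = qbin n (suc j)
      d = qbin n (suc (suc j))
      exponents : suc j ≤ n → Q₂ * D ≈ A * Q₁
      exponents 1+j≤n = begin
        Q₂ * D                               ≈⟨ ^ᴺ-homo-* q (suc (suc j)) (n ∸ suc j) ⟨
        q ^ᴺ (suc (suc j) +ℕ (n ∸ suc j))    ≡⟨ cong (λ e → q ^ᴺ suc e) (ℕ.m+[n∸m]≡n 1+j≤n) ⟩
        q ^ᴺ suc n                           ≡⟨ cong (λ e → q ^ᴺ suc e) (ℕ.m∸n+n≡m (ℕ.<⇒≤ 1+j≤n)) ⟨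
        q ^ᴺ suc ((n ∸ j) +ℕ j)              ≡⟨ cong (q ^ᴺ_) (ℕ.+-suc (n ∸ j) j) ⟨
        q ^ᴺ ((n ∸ j) +ℕ suc j)              ≈⟨ ^ᴺ-homo-* q (n ∸ j) (suc j) ⟩
        A * Q₁                               ∎

  qbin-sym : ∀ N j m → j +ℕ m ≡ N → qbin N j ≈ qbin N m
  qbin-sym zero zero zero _ = refl
  qbin-sym (suc N) zero m ≡-refl = sym (qbin-diag (suc N))
  qbin-sym (suc N) (suc j) zero j+0≡N =
    trans (≡⇒≈ (cong (qbin (suc N)) (≡-trans (≡-sym (ℕ.+-identityʳ (suc j))) j+0≡N))) (qbin-diag (suc N))
  qbin-sym (suc N) (suc j) (suc m) 2+j+m≡1+N = begin
      qbin N j + q ^ᴺ suc j * qbin N (suc j)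
        ≈⟨ +-cong (qbin-sym N j (suc m) j+1+m≡N)
                  (*-cong refl (qbin-sym N (suc j) m (≡-trans (≡-sym (ℕ.+-suc j m)) j+1+m≡N))) ⟩
      qbin N (suc m) + q ^ᴺ suc j * qbin N m
        ≈⟨ +-comm _ _ ⟩
      q ^ᴺ suc j * qbin N m + qbin N (suc m)
        ≡⟨ cong (λ e → q ^ᴺ e * qbin N m + qbin N (suc m)) N∸m≡1+j ⟨
      q ^ᴺ (N ∸ m) * qbin N m + qbin N (suc m)
        ≈⟨ qbin-pascalʳ N m ⟨
      qbin (suc N) (suc m) ∎
    where
      j+1+m≡N : j +ℕ suc m ≡ N
      j+1+m≡N = ℕ.suc-injective 2+j+m≡1+N
      N∸m≡1+j : N ∸ m ≡ suc j
      N∸m≡1+j = ≡-trans (cong (_∸ m) (≡-sym (≡-trans (≡-sym (ℕ.+-suc j m)) j+1+m≡N))) (ℕ.m+n∸n≡m (suc j) m)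

  qbinℤ-pascalˡ : ∀ n z → qbinℤ (suc n) z ≈ qbinℤ n (z -ℤ + 1) + qpow z * qbinℤ n z
  qbinℤ-pascalˡ n -[1+ m ] = sym (trans (+-identityˡ _) (zeroʳ _))
  qbinℤ-pascalˡ n (+ zero) = sym (trans (+-identityˡ _) (*-identityˡ _))
  qbinℤ-pascalˡ n (+ suc j) = refl

  qbinℤ-pascalʳ : ∀ n z → qbinℤ (suc n) z ≈ qpow (+ suc n -ℤ z) * qbinℤ n (z -ℤ + 1) + qbinℤ n z
  qbinℤ-pascalʳ n -[1+ m ] = sym (trans (+-identityʳ _) (zeroʳ _))
  qbinℤ-pascalʳ n (+ zero) = sym (trans (+-cong (zeroʳ _) refl) (+-identityˡ _))
  qbinℤ-pascalʳ n (+ suc j) = trans (qbin-pascalʳ n j) (+-cong (*-qbin-cong n j exponent) refl)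
    where
      exponent : j ≤ n → q ^ᴺ (n ∸ j) ≈ qpow (+ suc n -ℤ + suc j)
      exponent j≤n = ≡⇒≈ (cong qpow (≡-sym ([+m]-[+n]≡+[m∸n] (s≤s j≤n))))

  qbinℤ-sym : ∀ n z → qbinℤ n z ≈ qbinℤ n (+ n -ℤ z)
  qbinℤ-sym n -[1+ m ] = sym (qbin-above (ℕ.m<m+n n (s≤s z≤n)))
  qbinℤ-sym n (+ j) with ℕ.≤-<-connex j n
  ... | inj₁ j≤n = trans (qbin-sym n j (n ∸ j) (ℕ.m+[n∸m]≡n j≤n))
                         (≡⇒≈ (cong (qbinℤ n) (≡-sym ([+m]-[+n]≡+[m∸n] j≤n))))
  ... | inj₂ n<j = trans (qbin-above n<j) (≡⇒≈ (cong (qbinℤ n) (≡-sym ([+m]-[+n]≡-[1+n∸1+m] n<j))))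

  exponent₁ exponent₂ : ℕ → ℤ → ℤ
  exponent₁ n k = + 3 *ℤ k *ℤ k -ℤ k -ℤ + 3 *ℤ k *ℤ + n
  exponent₂ n k = + 3 *ℤ k *ℤ k +ℤ k -ℤ + 3 *ℤ k *ℤ + n

  term₁ term₂ term₃ : ℕ → ℤ → Carrier
  term₁ n k = qpow (exponent₁ n k) * qbinℤ n (+ 3 *ℤ k -ℤ + n)
  term₂ n k = qpow (exponent₂ n k) * qbinℤ n (+ 3 *ℤ k +ℤ + 1 -ℤ + n)
  term₃ n k = qpow (exponent₁ n k) * qbinℤ n (+ 3 *ℤ k -ℤ + 1 -ℤ + n)

  *-qbinℤ-negative : ∀ x n {j} m → j ≡ -[1+ m ] → x * qbinℤ n j ≈ 0#
  *-qbinℤ-negative x n m ≡-refl = zeroʳ x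

  *-qbinℤ-above : ∀ x n {j} t → j ≡ + suc (n +ℕ t) → x * qbinℤ n j ≈ 0#
  *-qbinℤ-above x n t ≡-refl = *-qbin-above x (s≤s (ℕ.m≤m+n n t))

  -- Instantiated at + m, + n, + t, both sides of each identity below compute to the literal
  -- forms -[1+ _ ] and + suc (n +ℕ _) that the two lemmas above match on.
  term₁-vanishes : ∀ n → VanishesOutside n (term₁ n)
  term₁-vanishes n = (λ m → *-qbinℤ-negative _ n _ (below (+ m) (+ n)))
                   , (λ t → *-qbinℤ-above _ n _ (above (+ n) (+ t)))
    where
      below : ∀ m n → + 3 *ℤ (-ℤ (+ 1 +ℤ m)) -ℤ n ≡ -ℤ (+ 3 +ℤ m +ℤ m +ℤ m +ℤ n)
      below = solve-∀
      above : ∀ n t → + 3 *ℤ (+ 1 +ℤ n +ℤ t) -ℤ n ≡ + 1 +ℤ n +ℤ (n +ℤ + 2 +ℤ t +ℤ t +ℤ t)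
      above = solve-∀

  term₂-vanishes : ∀ n → VanishesOutside n (term₂ n)
  term₂-vanishes n = (λ m → *-qbinℤ-negative _ n _ (below (+ m) (+ n)))
                   , (λ t → *-qbinℤ-above _ n _ (above (+ n) (+ t)))
    where
      below : ∀ m n → + 3 *ℤ (-ℤ (+ 1 +ℤ m)) +ℤ + 1 -ℤ n ≡ -ℤ (+ 2 +ℤ m +ℤ m +ℤ m +ℤ n)
      below = solve-∀
      above : ∀ n t → + 3 *ℤ (+ 1 +ℤ n +ℤ t) +ℤ + 1 -ℤ n ≡ + 1 +ℤ n +ℤ (n +ℤ + 3 +ℤ t +ℤ t +ℤ t)
      above = solve-∀

  term₃-vanishes : ∀ n → VanishesOutside n (term₃ n)
  term₃-vanishes n = (λ m → *-qbinℤ-negative _ n _ (below (+ m) (+ n)))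
                   , (λ t → *-qbinℤ-above _ n _ (above (+ n) (+ t)))
    where
      below : ∀ m n → + 3 *ℤ (-ℤ (+ 1 +ℤ m)) -ℤ + 1 -ℤ n ≡ -ℤ (+ 4 +ℤ m +ℤ m +ℤ m +ℤ n)
      below = solve-∀
      above : ∀ n t → + 3 *ℤ (+ 1 +ℤ n +ℤ t) -ℤ + 1 -ℤ n ≡ + 1 +ℤ n +ℤ (n +ℤ + 1 +ℤ t +ℤ t +ℤ t)
      above = solve-∀

  module _ (q*qinv≈1 : q * qinv ≈ 1#) where

    qpow-⊖ : ∀ m n → qpow (m ⊖ n) ≈ q ^ᴺ m * qinv ^ᴺ n
    qpow-⊖ zero zero = sym (*-identityʳ 1#)
    qpow-⊖ (suc m) zero = sym (*-identityʳ _)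
    qpow-⊖ zero (suc n) = sym (*-identityˡ _)
    qpow-⊖ (suc m) (suc n) = begin
      qpow (suc m ⊖ suc n)                  ≡⟨ cong qpow (ℤ.[1+m]⊖[1+n]≡m⊖n m n) ⟩
      qpow (m ⊖ n)                          ≈⟨ qpow-⊖ m n ⟩
      q ^ᴺ m * qinv ^ᴺ n                    ≈⟨ *-identityˡ _ ⟨
      1# * (q ^ᴺ m * qinv ^ᴺ n)             ≈⟨ *-cong q*qinv≈1 refl ⟨
      (q * qinv) * (q ^ᴺ m * qinv ^ᴺ n)     ≈⟨ interchange q qinv (q ^ᴺ m) (qinv ^ᴺ n) ⟩
      q ^ᴺ suc m * qinv ^ᴺ suc n            ∎

    qpow-homo : ∀ a b → qpow (a +ℤ b) ≈ qpow a * qpow b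
    qpow-homo (+ m) (+ n) = ^ᴺ-homo-* q m n
    qpow-homo (+ m) -[1+ n ] = qpow-⊖ m (suc n)
    qpow-homo -[1+ m ] (+ n) = trans (qpow-⊖ n (suc m)) (*-comm _ _)
    qpow-homo -[1+ m ] -[1+ n ] =
      trans (≡⇒≈ (cong (λ e → qinv ^ᴺ suc e) (≡-sym (ℕ.+-suc m n)))) (^ᴺ-homo-* qinv (suc m) (suc n))

    qpow*qpow-cong : ∀ a b c d → a +ℤ b ≡ c +ℤ d → qpow a * qpow b ≈ qpow c * qpow d
    qpow*qpow-cong a b c d eq = trans (sym (qpow-homo a b)) (trans (≡⇒≈ (cong qpow eq)) (qpow-homo c d))

    term₂-reflect : ∀ n k → qpow (-ℤ + n) * term₂ n k ≈ term₃ n (+ n -ℤ k)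
    term₂-reflect n k = begin
      qpow (-ℤ + n) * (qpow (exponent₂ n k) * qbinℤ n j)
        ≈⟨ *-assoc _ _ _ ⟨
      (qpow (-ℤ + n) * qpow (exponent₂ n k)) * qbinℤ n j
        ≈⟨ *-cong (sym (qpow-homo (-ℤ + n) (exponent₂ n k))) (qbinℤ-sym n j) ⟩
      qpow (-ℤ + n +ℤ exponent₂ n k) * qbinℤ n (+ n -ℤ j)
        ≡⟨ cong₂ (λ e i → qpow e * qbinℤ n i) (exponent (+ n) k) (index (+ n) k) ⟩
      term₃ n (+ n -ℤ k) ∎
      where
        j = + 3 *ℤ k +ℤ + 1 -ℤ + n
        exponent : ∀ n k → -ℤ n +ℤ (+ 3 *ℤ k *ℤ k +ℤ k -ℤ + 3 *ℤ k *ℤ n)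
                         ≡ + 3 *ℤ (n -ℤ k) *ℤ (n -ℤ k) -ℤ (n -ℤ k) -ℤ + 3 *ℤ (n -ℤ k) *ℤ n
        exponent = solve-∀
        index : ∀ n k → n -ℤ (+ 3 *ℤ k +ℤ + 1 -ℤ n) ≡ + 3 *ℤ (n -ℤ k) -ℤ + 1 -ℤ n
        index = solve-∀

    S₂≈S₃ : ∀ n → S₂ n ≈ S₃ n
    S₂≈S₃ n = begin
      qpow (-ℤ + n) * sumℤ (suc n) (term₂ n)                ≈⟨ *-cong refl (sumℤ-support n (term₂ n) (term₂-vanishes n)) ⟩
      qpow (-ℤ + n) * sumℕ (suc n) (λ i → term₂ n (+ i))    ≈⟨ sumℕ-*ˡ (suc n) _ _ ⟨
      sumℕ (suc n) (λ i → qpow (-ℤ + n) * term₂ n (+ i))    ≈⟨ sumℕ-cong (suc n) reflect ⟩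
      sumℕ (suc n) (λ i → term₃ n (+ (n ∸ i)))              ≈⟨ sumℕ-reverse (suc n) _ ⟨
      sumℕ (suc n) (λ i → term₃ n (+ i))                    ≈⟨ sumℤ-support n (term₃ n) (term₃-vanishes n) ⟨
      S₃ n                                                  ∎
      where
        reflect : ∀ i → i < suc n → qpow (-ℤ + n) * term₂ n (+ i) ≈ term₃ n (+ (n ∸ i))
        reflect i (s≤s i≤n) = trans (term₂-reflect n (+ i)) (≡⇒≈ (cong (term₃ n) ([+m]-[+n]≡+[m∸n] i≤n)))

    term₁-suc : ∀ n k → term₁ (suc n) k ≈ qpow (exponent₁ (suc n) k) * qbinℤ n (+ 3 *ℤ k -ℤ + 1 -ℤ + suc n)
                                          + qpow (-ℤ + suc n) * term₃ n k
    term₁-suc n k = begin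
      qpow e * qbinℤ (suc n) j
        ≈⟨ *-cong refl (qbinℤ-pascalˡ n j) ⟩
      qpow e * (qbinℤ n (j -ℤ + 1) + qpow j * qbinℤ n j)
        ≈⟨ distribˡ _ _ _ ⟩
      qpow e * qbinℤ n (j -ℤ + 1) + qpow e * (qpow j * qbinℤ n j)
        ≈⟨ +-cong (≡⇒≈ (cong (λ i → qpow e * qbinℤ n i) (index₁ k (+ n)))) (sym (*-assoc _ _ _)) ⟩
      qpow e * qbinℤ n j′ + (qpow e * qpow j) * qbinℤ n j
        ≈⟨ +-cong refl (*-cong (qpow*qpow-cong e j (-ℤ + suc n) (exponent₁ n k) (exponent k (+ n)))
                               (≡⇒≈ (cong (qbinℤ n) (index₂ k (+ n))))) ⟩
      qpow e * qbinℤ n j′ + (qpow (-ℤ + suc n) * qpow (exponent₁ n k)) * qbinℤ n (+ 3 *ℤ k -ℤ + 1 -ℤ + n)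
        ≈⟨ +-cong refl (*-assoc _ _ _) ⟩
      qpow e * qbinℤ n j′ + qpow (-ℤ + suc n) * term₃ n k ∎
      where
        e = exponent₁ (suc n) k
        j = + 3 *ℤ k -ℤ + suc n
        j′ = + 3 *ℤ k -ℤ + 1 -ℤ + suc n
        index₁ : ∀ k n → (+ 3 *ℤ k -ℤ (+ 1 +ℤ n)) -ℤ + 1 ≡ + 3 *ℤ k -ℤ + 1 -ℤ (+ 1 +ℤ n)
        index₁ = solve-∀
        index₂ : ∀ k n → + 3 *ℤ k -ℤ (+ 1 +ℤ n) ≡ + 3 *ℤ k -ℤ + 1 -ℤ n
        index₂ = solve-∀
        exponent : ∀ k n → (+ 3 *ℤ k *ℤ k -ℤ k -ℤ + 3 *ℤ k *ℤ (+ 1 +ℤ n)) +ℤ (+ 3 *ℤ k -ℤ (+ 1 +ℤ n))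
                           ≡ -ℤ (+ 1 +ℤ n) +ℤ (+ 3 *ℤ k *ℤ k -ℤ k -ℤ + 3 *ℤ k *ℤ n)
        exponent = solve-∀

    term₃-suc : ∀ n k → term₃ (suc n) k ≈ qpow (exponent₁ (suc n) k) * qbinℤ n (+ 3 *ℤ k -ℤ + 1 -ℤ + suc n)
                                          + qpow (-ℤ + suc n) * term₁ n (k -ℤ + 1)
    term₃-suc n k = begin
      qpow e * qbinℤ (suc n) j
        ≈⟨ *-cong refl (qbinℤ-pascalʳ n j) ⟩
      qpow e * (qpow (+ suc n -ℤ j) * qbinℤ n (j -ℤ + 1) + qbinℤ n j)
        ≈⟨ trans (distribˡ _ _ _) (+-comm _ _) ⟩
      qpow e * qbinℤ n j + qpow e * (qpow (+ suc n -ℤ j) * qbinℤ n (j -ℤ + 1))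
        ≈⟨ +-cong refl (sym (*-assoc _ _ _)) ⟩
      qpow e * qbinℤ n j + (qpow e * qpow (+ suc n -ℤ j)) * qbinℤ n (j -ℤ + 1)
        ≈⟨ +-cong refl (*-cong (qpow*qpow-cong e (+ suc n -ℤ j) (-ℤ + suc n) (exponent₁ n (k -ℤ + 1)) (exponent k (+ n)))
                               (≡⇒≈ (cong (qbinℤ n) (index k (+ n))))) ⟩
      qpow e * qbinℤ n j + (qpow (-ℤ + suc n) * qpow (exponent₁ n (k -ℤ + 1))) * qbinℤ n (+ 3 *ℤ (k -ℤ + 1) -ℤ + n)
        ≈⟨ +-cong refl (*-assoc _ _ _) ⟩
      qpow e * qbinℤ n j + qpow (-ℤ + suc n) * term₁ n (k -ℤ + 1) ∎
      where
        e = exponent₁ (suc n) k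
        j = + 3 *ℤ k -ℤ + 1 -ℤ + suc n
        index : ∀ k n → (+ 3 *ℤ k -ℤ + 1 -ℤ (+ 1 +ℤ n)) -ℤ + 1 ≡ + 3 *ℤ (k -ℤ + 1) -ℤ n
        index = solve-∀
        exponent : ∀ k n → (+ 3 *ℤ k *ℤ k -ℤ k -ℤ + 3 *ℤ k *ℤ (+ 1 +ℤ n))
                             +ℤ ((+ 1 +ℤ n) -ℤ (+ 3 *ℤ k -ℤ + 1 -ℤ (+ 1 +ℤ n)))
                           ≡ -ℤ (+ 1 +ℤ n)
                             +ℤ (+ 3 *ℤ (k -ℤ + 1) *ℤ (k -ℤ + 1) -ℤ (k -ℤ + 1) -ℤ + 3 *ℤ (k -ℤ + 1) *ℤ n)
        exponent = solve-∀

    term₁-term₃-suc : ∀ n k → term₁ (suc n) k - term₃ (suc n) k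
                              ≈ qpow (-ℤ + suc n) * (term₃ n k - term₁ n (k -ℤ + 1))
    term₁-term₃-suc n k = trans (+-cong (term₁-suc n k) (-‿cong (term₃-suc n k)))
                                (trans ([x+y]-[x+z]≈y-z _ _ _) (sym (x[y-z]≈xy-xz _ _ _)))

    S₁-S₃-suc : ∀ n → S₁ (suc n) - S₃ (suc n) ≈ qpow (-ℤ + suc n) * (S₃ n - S₁ n)
    S₁-S₃-suc n = begin
      S₁ (suc n) - S₃ (suc n)
        ≈⟨ +-cong (sumℤ-support (suc n) (term₁ (suc n)) (term₁-vanishes (suc n)))
                  (-‿cong (sumℤ-support (suc n) (term₃ (suc n)) (term₃-vanishes (suc n)))) ⟩
      sumℕ (suc (suc n)) (λ i → term₁ (suc n) (+ i)) - sumℕ (suc (suc n)) (λ i → term₃ (suc n) (+ i))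
        ≈⟨ sumℕ-minus (suc (suc n)) _ _ ⟨
      sumℕ (suc (suc n)) (λ i → term₁ (suc n) (+ i) - term₃ (suc n) (+ i))
        ≈⟨ sumℕ-cong (suc (suc n)) (λ i _ → term₁-term₃-suc n (+ i)) ⟩
      sumℕ (suc (suc n)) (λ i → q^-[1+n] * (term₃ n (+ i) - term₁ n (+ i -ℤ + 1)))
        ≈⟨ trans (sumℕ-*ˡ (suc (suc n)) q^-[1+n] _) (*-cong refl (sumℕ-minus (suc (suc n)) _ _)) ⟩
      q^-[1+n] * (sumℕ (suc (suc n)) (λ i → term₃ n (+ i)) - sumℕ (suc (suc n)) (λ i → term₁ n (+ i -ℤ + 1)))
        ≈⟨ *-cong refl (+-cong (sumℕ-support-suc n (term₃ n) (term₃-vanishes n))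
                               (-‿cong (sumℕ-window 1 0 n (term₁ n) (cong suc (ℕ.+-comm 1 n)) (term₁-vanishes n)))) ⟩
      q^-[1+n] * (sumℕ (suc n) (λ i → term₃ n (+ i)) - sumℕ (suc n) (λ i → term₁ n (+ i)))
        ≈⟨ *-cong refl (+-cong (sumℤ-support n (term₃ n) (term₃-vanishes n))
                               (-‿cong (sumℤ-support n (term₁ n) (term₁-vanishes n)))) ⟨
      q^-[1+n] * (S₃ n - S₁ n) ∎
      where
        q^-[1+n] = qpow (-ℤ + suc n)

    RHS-suc : ∀ n → RHS (suc n) ≈ qpow (-ℤ + suc n) * - RHS n
    RHS-suc n = begin
      (- 1# * s) * qpow (-ℤ + (suc (suc n) C 2))
        ≡⟨ cong (λ m → (- 1# * s) * qpow (-ℤ + m)) [n+2]C2≡[n+1]+[n+1]C2 ⟩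
      (- 1# * s) * qpow (-ℤ (+ suc n +ℤ + (suc n C 2)))
        ≈⟨ *-cong (-1*x≈-x s) (trans (≡⇒≈ (cong qpow (ℤ.neg-distrib-+ (+ suc n) (+ (suc n C 2)))))
                                     (qpow-homo (-ℤ + suc n) (-ℤ + (suc n C 2)))) ⟩
      - s * (q^-[1+n] * p)
        ≈⟨ x*[y*z]≈y*[x*z] (- s) q^-[1+n] p ⟩
      q^-[1+n] * (- s * p)
        ≈⟨ *-cong refl (-‿distribˡ-* s p) ⟨
      q^-[1+n] * - (s * p) ∎
      where
        s = (- 1#) ^ᴺ n
        q^-[1+n] = qpow (-ℤ + suc n)
        p = qpow (-ℤ + (suc n C 2))
        [n+2]C2≡[n+1]+[n+1]C2 : suc (suc n) C 2 ≡ suc n +ℕ suc n C 2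
        [n+2]C2≡[n+1]+[n+1]C2 = ≡-trans (≡-sym (nCk+nC[k+1]≡[n+1]C[k+1] (suc n) 1)) (cong (_+ℕ suc n C 2) (nC1≡n (suc n)))

    S₁-S₃≈RHS : ∀ n → S₁ n - S₃ n ≈ RHS n
    S₁-S₃≈RHS zero = begin
      S₁ 0 - S₃ 0                        ≈⟨ +-cong (sumℤ-support 0 (term₁ 0) (term₁-vanishes 0))
                                                   (-‿cong (sumℤ-support 0 (term₃ 0) (term₃-vanishes 0))) ⟩
      (1# * 1# + 0#) - (1# * 0# + 0#)    ≈⟨ +-cong (+-identityʳ _) (-‿cong (trans (+-identityʳ _) (zeroʳ 1#))) ⟩
      1# * 1# - 0#                       ≈⟨ trans (+-cong refl ε⁻¹≈ε) (+-identityʳ _) ⟩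
      1# * 1#                            ∎
    S₁-S₃≈RHS (suc n) = begin
      S₁ (suc n) - S₃ (suc n)                ≈⟨ S₁-S₃-suc n ⟩
      qpow (-ℤ + suc n) * (S₃ n - S₁ n)      ≈⟨ *-cong refl (⁻¹-anti-homo‿- (S₁ n) (S₃ n)) ⟨
      qpow (-ℤ + suc n) * - (S₁ n - S₃ n)    ≈⟨ *-cong refl (-‿cong (S₁-S₃≈RHS n)) ⟩
      qpow (-ℤ + suc n) * - RHS n            ≈⟨ RHS-suc n ⟨
      RHS (suc n)                            ∎

proposition6 : {c ℓ : Level} (R : CommutativeRing c ℓ) (q qinv : CommutativeRing.Carrier R) →
    CommutativeRing._≈_ R (CommutativeRing._*_ R q qinv) (CommutativeRing.1# R) →
    (n : ℕ) →
    let open CommutativeRing R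
        open QDefs R q qinv
    in (S₂ n ≈ S₃ n) × (S₁ n - S₃ n ≈ RHS n)
proposition6 R q qinv q*qinv≈1 n = S₂≈S₃ R q qinv q*qinv≈1 n , S₁-S₃≈RHS R q qinv q*qinv≈1 n
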